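{- Let $R,k$ be positive integers. (a) If $R$ is even, the circulant graph $C_{k(R+1)2^{1+\lceil\log R\rceil}}(\{1,2,\dots,R\})$ admits an adjacent vertex-distinguishing proper edge-coloring with $2R+1$ colors. (b) If $R$ is odd, the circulant graph $C_{k(R+2)2^{1+\lceil\log R\rceil}}(\{1,2,\dots,R\})$ admits an adjacent vertex-distinguishing proper edge-coloring with $2R+1$ colors.
   Context: $\log$ denotes the base-2 logarithm. For $n\in\mathbb{N}^*$ and $S\subset\mathbb{Z}_n$, the circulant graph $C_n(S)$ is the simple undirected graph with vertex set $\mathbb{Z}_n$ in which $i$ and $j$ are adjacent if and only if $i-j\equiv \pm s \pmod n$ for some $s\in S$. A proper edge-coloring assigns colors to edges so that edges sharing an endpoint get different colors; it is adjacent vertex-distinguishing if for every edge $uv$ the set of colors of edges incident to $u$ differs from the set of colors of edges incident to $v$. -}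

module Defs where

open import Data.Nat using (ℕ; zero; suc; _+_; _*_; _∸_; _^_; _≤_; _<_; NonZero)
open import Data.Fin using (Fin; toℕ)
open import Data.Product using (Σ; _×_; ∃-syntax)
open import Data.Sum using (_⊎_)
open import Relation.Binary.PropositionalEquality using (_≡_; _≢_)
open import Relation.Nullary using (¬_)

_≡_[mod_] : ℕ → ℕ → ℕ → Set
x ≡ y [mod n ] = ∃[ a ] ∃[ b ] (x + a * n ≡ y + b * n)

-- The circulant graph C_n(S) on vertex set ℤ_n = Fin n, with S given as a
-- predicate on ℕ (elements of S represented by natural numbers, taken mod n).
-- i ~ j  iff  i ≠ j  and  i - j ≡ ± s (mod n)  for some s ∈ S.
Circulant : (n : ℕ) → (ℕ → Set) → Fin n → Fin n → Set
Circulant n S i j =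
  (i ≢ j) ×
  (∃[ s ] (S s × ((toℕ i ≡ toℕ j + s [mod n ]) ⊎ (toℕ j ≡ toℕ i + s [mod n ]))))

IsEven IsOdd : ℕ → Set
IsEven R = ∃[ t ] (R ≡ 2 * t)
IsOdd  R = ∃[ t ] (R ≡ 1 + 2 * t)

UpTo : ℕ → ℕ → Set
UpTo R s = (1 ≤ s) × (s ≤ R)

-- An edge-coloring with m colors: a color for each ordered adjacent pair,
-- symmetric so that it is really a coloring of undirected edges.
record EdgeColoring (n m : ℕ) (Adj : Fin n → Fin n → Set) : Set where
  field
    color : (u v : Fin n) → Adj u v → Fin m
    symm  : (u v : Fin n) (p : Adj u v) (q : Adj v u) → color u v p ≡ color v u q

open EdgeColoring public

-- proper: two edges sharing an endpoint u get different colors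
-- (also required for parallel proofs of the same edge to agree, handled by symm/irrelevance below)
Proper : {n m : ℕ} {Adj : Fin n → Fin n → Set} → EdgeColoring n m Adj → Set
Proper {n} {m} {Adj} c =
  (u v w : Fin n) (p : Adj u v) (q : Adj u w) → v ≢ w → color c u v p ≢ color c u w q

WellDefined : {n m : ℕ} {Adj : Fin n → Fin n → Set} → EdgeColoring n m Adj → Set
WellDefined {n} {m} {Adj} c =
  (u v : Fin n) (p q : Adj u v) → color c u v p ≡ color c u v q

InColorSet : {n m : ℕ} {Adj : Fin n → Fin n → Set} → EdgeColoring n m Adj → Fin n → Fin m → Set
InColorSet {n} {m} {Adj} c u a = ∃[ v ] Σ (Adj u v) (λ p → color c u v p ≡ a)

AVD : {n m : ℕ} {Adj : Fin n → Fin n → Set} → EdgeColoring n m Adj → Set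
AVD {n} {m} {Adj} c =
  (u v : Fin n) → Adj u v →
  ¬ ((a : Fin m) → (InColorSet c u a → InColorSet c v a) × (InColorSet c v a → InColorSet c u a))

HasAVDColoring : (n m : ℕ) (Adj : Fin n → Fin n → Set) → Set
HasAVDColoring n m Adj =
  Σ (EdgeColoring n m Adj) λ c → WellDefined c × Proper c × AVD c

module Submission where

-- Let q = 1 + 2h be odd with R < q ≤ R + 2, let R ≤ 2^c, and let n > 2R be a
-- multiple of both q and 2^(1+c).  Every edge of C_n({1..R}) is a forward
-- step of length d ∈ {1..R} from a unique base vertex x, and is coloured
--   (x + d/2) mod q              (halving in ℤ_q)  if d is odd,
--   q + d - 2 + [⌊x/T⌋ is odd]   (T the 2-part of d)  if d is even.
-- Proper: seen from a vertex x, an odd colour c satisfies 2c ≡ 2x ± d mod q,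
-- which determines the step since q is odd; an even colour determines d, and
-- its last bit the direction, since moving by d flips the parity of ⌊x/T⌋
-- (this uses 2T ∣ n).  Distinguishing: the colour x mod q is missing at x but
-- present at each neighbour x ± e, via an odd step of length |q - 2e| ≤ R.
-- The colours fit into 2R + 1 for q = R + 1 (R even) and q = R + 2 (R odd),
-- and n = k·q·2^(1+⌈log₂ R⌉) meets all requirements.

open import Defs
open import Data.Nat.Base
open import Data.Nat.Properties
open import Data.Nat.DivMod
open import Data.Nat.Divisibility using (_∣_; m%n≡0⇒n∣m; divides; ∣-trans; n∣m*n; ∣n⇒∣m*n; m∣m*n; *-monoʳ-∣)
open import Data.Nat.Induction using (<-rec; <-wellFounded)
open import Data.Nat.Logarithm.Core using (⌈log2⌉)
open import Induction.WellFounded using (Acc; acc)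
open import Data.Nat.Logarithm using (⌈log₂_⌉)
open import Data.Nat.Tactic.RingSolver using (solve)
open import Data.Parity.Base as ℙ using (Parity; 0ℙ; 1ℙ; _⁻¹)
import Data.Parity.Properties as ℙₚ
open import Data.List.Base using (_∷_; [])
open import Data.Fin.Base using (Fin; toℕ)
open import Data.Fin.Properties using (toℕ-fromℕ<; toℕ-injective; toℕ<n)
open import Data.Product using (∃-syntax; _×_; _,_; proj₁; proj₂; uncurry)
open import Data.Sum using (_⊎_; inj₁; inj₂)
open import Data.Empty using (⊥; ⊥-elim)
open import Level using (0ℓ)
open import Relation.Binary.Bundles using (Setoid)
import Relation.Binary.Reasoning.Setoid as SetoidReasoning
open import Relation.Binary.PropositionalEquality
open import Relation.Nullary using (¬_; yes; no)

module _ {m : ℕ} where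

  ≡mod-refl : ∀ {x} → x ≡ x [mod m ]
  ≡mod-refl = 0 , 0 , refl

  ≡⇒≡mod : ∀ {x y} → x ≡ y → x ≡ y [mod m ]
  ≡⇒≡mod refl = ≡mod-refl

  ≡mod-sym : ∀ {x y} → x ≡ y [mod m ] → y ≡ x [mod m ]
  ≡mod-sym (a , b , e) = b , a , sym e

  ≡mod-trans : ∀ {x y z} → x ≡ y [mod m ] → y ≡ z [mod m ] → x ≡ z [mod m ]
  ≡mod-trans {x} {y} {z} (a , b , e) (c , d , f) = a + c , d + b , (begin
    x + (a + c) * m      ≡⟨ solve (x ∷ a ∷ c ∷ m ∷ []) ⟩
    (x + a * m) + c * m  ≡⟨ cong (_+ c * m) e ⟩
    (y + b * m) + c * m  ≡⟨ solve (y ∷ b ∷ c ∷ m ∷ []) ⟩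
    (y + c * m) + b * m  ≡⟨ cong (_+ b * m) f ⟩
    (z + d * m) + b * m  ≡⟨ solve (z ∷ d ∷ b ∷ m ∷ []) ⟩
    z + (d + b) * m      ∎)
    where open ≡-Reasoning

  +-cong-mod : ∀ {x y u v} → x ≡ y [mod m ] → u ≡ v [mod m ] → (x + u) ≡ y + v [mod m ]
  +-cong-mod {x} {y} {u} {v} (a , b , e) (c , d , f) = a + c , b + d , (begin
    x + u + (a + c) * m        ≡⟨ solve (x ∷ u ∷ a ∷ c ∷ m ∷ []) ⟩
    (x + a * m) + (u + c * m)  ≡⟨ cong₂ _+_ e f ⟩
    (y + b * m) + (v + d * m)  ≡⟨ solve (y ∷ v ∷ b ∷ d ∷ m ∷ []) ⟩
    y + v + (b + d) * m        ∎)
    where open ≡-Reasoning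

  *-congˡ-mod : ∀ {x y} c → x ≡ y [mod m ] → (c * x) ≡ c * y [mod m ]
  *-congˡ-mod {x} {y} c (a , b , e) = c * a , c * b , (begin
    c * x + c * a * m  ≡⟨ solve (c ∷ x ∷ a ∷ m ∷ []) ⟩
    c * (x + a * m)    ≡⟨ cong (c *_) e ⟩
    c * (y + b * m)    ≡⟨ solve (c ∷ y ∷ b ∷ m ∷ []) ⟩
    c * y + c * b * m  ∎)
    where open ≡-Reasoning

  +-cancelʳ-mod : ∀ {x y} u → (x + u) ≡ y + u [mod m ] → x ≡ y [mod m ]
  +-cancelʳ-mod {x} {y} u (a , b , e) = a , b , +-cancelʳ-≡ u _ _ (begin
    x + a * m + u  ≡⟨ solve (x ∷ a ∷ m ∷ u ∷ []) ⟩
    x + u + a * m  ≡⟨ e ⟩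
    y + u + b * m  ≡⟨ solve (y ∷ u ∷ b ∷ m ∷ []) ⟩
    y + b * m + u  ∎)
    where open ≡-Reasoning

  +-cancelˡ-mod : ∀ u {x y} → (u + x) ≡ u + y [mod m ] → x ≡ y [mod m ]
  +-cancelˡ-mod u {x} {y} p =
    +-cancelʳ-mod u (subst₂ (λ s t → s ≡ t [mod m ]) (+-comm u x) (+-comm u y) p)

  +-multiple-mod : ∀ x k → (x + k * m) ≡ x [mod m ]
  +-multiple-mod x k = 0 , k , +-identityʳ _

  ≡mod⇒%≡ : ∀ {x y} .{{_ : NonZero m}} → x ≡ y [mod m ] → x % m ≡ y % m
  ≡mod⇒%≡ {x} {y} (a , b , e) = begin
    x % m            ≡⟨ [m+kn]%n≡m%n x a m ⟨
    (x + a * m) % m  ≡⟨ cong (_% m) e ⟩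
    (y + b * m) % m  ≡⟨ [m+kn]%n≡m%n y b m ⟩
    y % m            ∎
    where open ≡-Reasoning

  ≡mod-unique : ∀ {x y} .{{_ : NonZero m}} → x < m → y < m → x ≡ y [mod m ] → x ≡ y
  ≡mod-unique {x} {y} x<m y<m x≡y = begin
    x      ≡⟨ m<n⇒m%n≡m x<m ⟨
    x % m  ≡⟨ ≡mod⇒%≡ x≡y ⟩
    y % m  ≡⟨ m<n⇒m%n≡m y<m ⟩
    y      ∎
    where open ≡-Reasoning

  multiple-between : ∀ {a} .{{_ : NonZero m}} → a ≡ 0 [mod m ] → 0 < a → a < m + m → a ≡ m
  multiple-between {a} a≡0 0<a a<2m with m%n≡0⇒n∣m a m (trans (≡mod⇒%≡ a≡0) (m<n⇒m%n≡m (>-nonZero⁻¹ m)))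
  ... | divides zero a≡0*m = ⊥-elim (<⇒≢ 0<a (sym a≡0*m))
  ... | divides (suc zero) a≡1*m = trans a≡1*m (+-identityʳ m)
  ... | divides (suc (suc j)) a≡[2+j]*m =
    ⊥-elim (<⇒≱ a<2m (subst (m + m ≤_) (sym (trans a≡[2+j]*m (sym (+-assoc m m (j * m)))))
                                    (m≤m+n (m + m) (j * m))))

  %-≡mod : ∀ x .{{_ : NonZero m}} → (x % m) ≡ x [mod m ]
  %-≡mod x = x / m , 0 , trans (sym (m≡m%n+[m/n]*n x m)) (sym (+-identityʳ x))

≡mod-weaken : ∀ {d m x y} → d ∣ m → x ≡ y [mod m ] → x ≡ y [mod d ]
≡mod-weaken {d} {m} {x} {y} (divides j refl) (a , b , e) = a * j , b * j ,
  trans (cong (x +_) (*-assoc a j d)) (trans e (cong (y +_) (sym (*-assoc b j d))))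

≡mod-setoid : ℕ → Setoid 0ℓ 0ℓ
≡mod-setoid m = record
  { Carrier = ℕ
  ; _≈_ = λ x y → x ≡ y [mod m ]
  ; isEquivalence = record { refl = ≡mod-refl ; sym = ≡mod-sym ; trans = ≡mod-trans }
  }

module ≡mod-Reasoning (m : ℕ) = SetoidReasoning (≡mod-setoid m)

reduce-sum : ∀ {x y d} n .{{_ : NonZero n}} → x < n → y < n → d < n →
             y ≡ x + d [mod n ] → y ≡ x + d ⊎ y + n ≡ x + d
reduce-sum {x} {y} {d} n x<n y<n d<n y≡x+d with x + d <? n
... | yes x+d<n = inj₁ (≡mod-unique y<n x+d<n y≡x+d)
... | no x+d≮n = inj₂ (begin
    y + n            ≡⟨ cong (_+ n) (≡mod-unique y<n x+d-n<n y≡x+d-n) ⟩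
    (x + d ∸ n) + n  ≡⟨ m∸n+n≡m n≤x+d ⟩
    x + d            ∎)
  where
  open ≡-Reasoning
  n≤x+d : n ≤ x + d
  n≤x+d = ≮⇒≥ x+d≮n
  x+d-n<n : x + d ∸ n < n
  x+d-n<n = ≤-<-trans (∸-monoˡ-≤ n (+-monoʳ-≤ x (<⇒≤ d<n))) (subst (_< n) (sym (m+n∸n≡m x n)) x<n)
  y≡x+d-n : y ≡ x + d ∸ n [mod n ]
  y≡x+d-n = ≡mod-trans y≡x+d (0 , 1 , (begin
    x + d + 0 * n      ≡⟨ +-identityʳ (x + d) ⟩
    x + d              ≡⟨ m∸n+n≡m n≤x+d ⟨
    x + d ∸ n + n      ≡⟨ cong (x + d ∸ n +_) (+-identityʳ n) ⟨
    x + d ∸ n + 1 * n  ∎))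

even-or-odd : ∀ n → IsEven n ⊎ IsOdd n
even-or-odd zero = inj₁ (0 , refl)
even-or-odd (suc n) with even-or-odd n
... | inj₁ (t , n≡2t) = inj₂ (t , cong suc n≡2t)
... | inj₂ (t , n≡1+2t) = inj₁ (suc t , trans (cong suc n≡1+2t) (solve (t ∷ [])))

parity-even : ∀ t → parity (2 * t) ≡ 0ℙ
parity-even t = ℙₚ.*-homo-* 2 t

parity-odd : ∀ t → parity (1 + 2 * t) ≡ 1ℙ
parity-odd t = trans (ℙₚ.+-homo-+ 1 (2 * t)) (cong _⁻¹ (parity-even t))

IsOdd⇒parity : ∀ {d} → IsOdd d → parity d ≡ 1ℙ
IsOdd⇒parity (t , refl) = parity-odd t

data Shape : ℕ → Set where
  odd  : ∀ t → Shape (1 + 2 * t)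
  even : ∀ t → Shape (2 * suc t)

shape : ∀ {d} → 1 ≤ d → Shape d
shape {d} 1≤d with even-or-odd d
... | inj₂ (t , refl) = odd t
... | inj₁ (suc t , refl) = even t
... | inj₁ (zero , refl) with () ← 1≤d

bit : Parity → ℕ
bit 0ℙ = 0
bit 1ℙ = 1

bit≤1 : ∀ p → bit p ≤ 1
bit≤1 0ℙ = z≤n
bit≤1 1ℙ = ≤-refl

even+bit-injective : ∀ a a' p p' → 2 * a + bit p ≡ 2 * a' + bit p' → a ≡ a' × p ≡ p'
even+bit-injective a a' p p' e =
  *-cancelˡ-≡ a a' 2 (+-cancelʳ-≡ (bit p') _ _ (subst (λ r → 2 * a + bit r ≡ 2 * a' + bit p') p≡p' e)) , p≡p'
  where
  parity-bit : ∀ p → parity (bit p) ≡ p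
  parity-bit 0ℙ = refl
  parity-bit 1ℙ = refl
  parity-of : ∀ a p → parity (2 * a + bit p) ≡ p
  parity-of a p = trans (ℙₚ.+-homo-+ (2 * a) (bit p))
                        (trans (cong (ℙ._+ parity (bit p)) (parity-even a)) (parity-bit p))
  p≡p' : p ≡ p'
  p≡p' = trans (sym (parity-of a p)) (trans (cong parity e) (parity-of a' p'))

-- The parity of ⌊x / T⌋.  It is additive along multiples of T, and hence
-- invariant along multiples of 2T and flipped by odd multiples of T.
module _ {T : ℕ} .{{_ : NonZero T}} where

  parity-/-+ : ∀ x {w} → T ∣ w → parity ((x + w) / T) ≡ parity (x / T) ℙ.+ parity (w / T)
  parity-/-+ x T∣w = trans (cong parity (+-distrib-/-∣ʳ x T∣w)) (ℙₚ.+-homo-+ (x / T) _)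

  parity-/-invariant : ∀ x {w} → 2 * T ∣ w → parity ((x + w) / T) ≡ parity (x / T)
  parity-/-invariant x {w} 2T∣w@(divides j w≡j*2T) = begin
    parity ((x + w) / T)               ≡⟨ parity-/-+ x (∣-trans (n∣m*n 2) 2T∣w) ⟩
    parity (x / T) ℙ.+ parity (w / T)  ≡⟨ cong (λ z → parity (x / T) ℙ.+ parity z) w/T≡2j ⟩
    parity (x / T) ℙ.+ parity (2 * j)  ≡⟨ cong (parity (x / T) ℙ.+_) (parity-even j) ⟩
    parity (x / T) ℙ.+ 0ℙ              ≡⟨ ℙₚ.+-identityʳ _ ⟩
    parity (x / T)                     ∎
    where
    open ≡-Reasoning
    w/T≡2j : w / T ≡ 2 * j
    w/T≡2j = begin
      w / T            ≡⟨ cong (_/ T) w≡j*2T ⟩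
      j * (2 * T) / T  ≡⟨ cong (_/ T) (solve (j ∷ T ∷ [])) ⟩
      2 * j * T / T    ≡⟨ m*n/n≡m (2 * j) T ⟩
      2 * j            ∎

  parity-flip : ∀ {d n x y} → T ∣ d → parity (d / T) ≡ 1ℙ → 2 * T ∣ n →
                x ≡ y + d [mod n ] → parity (x / T) ≡ parity (y / T) ⁻¹
  parity-flip {d} {n} {x} {y} T∣d d/T-odd 2T∣n (a , b , e) = begin
    parity (x / T)                     ≡⟨ parity-/-invariant x (∣n⇒∣m*n a 2T∣n) ⟨
    parity ((x + a * n) / T)           ≡⟨ cong (λ z → parity (z / T)) e ⟩
    parity ((y + d + b * n) / T)       ≡⟨ parity-/-invariant (y + d) (∣n⇒∣m*n b 2T∣n) ⟩
    parity ((y + d) / T)               ≡⟨ parity-/-+ y T∣d ⟩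
    parity (y / T) ℙ.+ parity (d / T)  ≡⟨ cong (parity (y / T) ℙ.+_) d/T-odd ⟩
    parity (y / T) ℙ.+ 1ℙ              ≡⟨ ℙₚ.+-comm (parity (y / T)) 1ℙ ⟩
    parity (y / T) ⁻¹                  ∎
    where open ≡-Reasoning

odd-decomposition : ∀ m → ∃[ v ] ∃[ o ] suc m ≡ 2 ^ v * (1 + 2 * o)
odd-decomposition = <-rec _ decompose
  where
  decompose : ∀ m → (∀ {j} → j < m → ∃[ v ] ∃[ o ] suc j ≡ 2 ^ v * (1 + 2 * o)) →
              ∃[ v ] ∃[ o ] suc m ≡ 2 ^ v * (1 + 2 * o)
  decompose m rec with even-or-odd m
  ... | inj₁ (o , refl) = 0 , o , sym (*-identityˡ _)
  ... | inj₂ (j , refl) with rec {j} (s≤s (m≤m+n j (j + 0)))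
  ...   | v , o , 1+j≡2^v*odd = suc v , o , (begin
    2 + 2 * j                    ≡⟨ solve (j ∷ []) ⟩
    2 * suc j                    ≡⟨ cong (2 *_) 1+j≡2^v*odd ⟩
    2 * (2 ^ v * (1 + 2 * o))    ≡⟨ *-assoc 2 (2 ^ v) _ ⟨
    2 ^ suc v * (1 + 2 * o)      ∎)
    where open ≡-Reasoning

twoPart : ℕ → ℕ
twoPart d = 2 ^ proj₁ (odd-decomposition (pred d))

twoPart-nonZero : ∀ d → NonZero (twoPart d)
twoPart-nonZero d = m^n≢0 2 (proj₁ (odd-decomposition (pred d)))

block : ℕ → ℕ → ℕ
block d x = _/_ x (twoPart d) {{twoPart-nonZero d}}

pow2-∣ : ∀ {v c} → 2 ^ v ≤ 2 ^ c → 2 ^ v ∣ 2 ^ c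
pow2-∣ {v} {c} 2^v≤2^c with v ≤? c
... | yes v≤c = divides (2 ^ (c ∸ v))
      (trans (cong (2 ^_) (sym (m∸n+n≡m v≤c))) (^-distribˡ-+-* 2 (c ∸ v) v))
... | no v≰c = ⊥-elim (<⇒≱ (^-monoʳ-< 2 (s≤s (s≤s z≤n)) (≰⇒> v≰c)) 2^v≤2^c)

module _ (m : ℕ) where

  private
    v o : ℕ
    v = proj₁ (odd-decomposition m)
    o = proj₁ (proj₂ (odd-decomposition m))
    1+m≡T*odd : suc m ≡ twoPart (suc m) * (1 + 2 * o)
    1+m≡T*odd = proj₂ (proj₂ (odd-decomposition m))
    instance
      twoPart-nonZero-suc : NonZero (twoPart (suc m))
      twoPart-nonZero-suc = twoPart-nonZero (suc m)

  twoPart-∣ : twoPart (suc m) ∣ suc m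
  twoPart-∣ = divides (1 + 2 * o) (trans 1+m≡T*odd (*-comm (twoPart (suc m)) _))

  twoPart-cofactor : parity (block (suc m) (suc m)) ≡ 1ℙ
  twoPart-cofactor = begin
    parity (suc m / T)                    ≡⟨ cong (λ z → parity (z / T)) 1+m≡T*odd ⟩
    parity (T * (1 + 2 * o) / T)          ≡⟨ cong (λ z → parity (z / T)) (*-comm T (1 + 2 * o)) ⟩
    parity ((1 + 2 * o) * T / T)          ≡⟨ cong parity (m*n/n≡m (1 + 2 * o) T) ⟩
    parity (1 + 2 * o)                    ≡⟨ parity-odd o ⟩
    1ℙ                                    ∎
    where
    open ≡-Reasoning
    T : ℕ
    T = twoPart (suc m)

  double-twoPart-∣ : ∀ {c} → suc m ≤ 2 ^ c → 2 * twoPart (suc m) ∣ 2 ^ suc c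
  double-twoPart-∣ {c} 1+m≤2^c = *-monoʳ-∣ 2 (pow2-∣ {v} {c} (begin
    twoPart (suc m)                  ≤⟨ m≤m*n (twoPart (suc m)) (1 + 2 * o) ⟩
    twoPart (suc m) * (1 + 2 * o)    ≡⟨ 1+m≡T*odd ⟨
    suc m                            ≤⟨ 1+m≤2^c ⟩
    2 ^ c                            ∎))
    where open ≤-Reasoning

n≤2^⌈log2⌉ : ∀ n (rs : Acc _<_ n) → n ≤ 2 ^ ⌈log2⌉ n rs
n≤2^⌈log2⌉ zero _ = z≤n
n≤2^⌈log2⌉ (suc zero) _ = s≤s z≤n
n≤2^⌈log2⌉ (suc (suc n)) (acc rs) = begin
  suc (suc n)                       ≤⟨ s≤s (s≤s n≤2⌈n/2⌉) ⟩
  suc (suc (⌈ n /2⌉ + ⌈ n /2⌉))     ≡⟨ double-suc ⌈ n /2⌉ ⟩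
  2 * suc ⌈ n /2⌉                   ≤⟨ *-monoʳ-≤ 2 (n≤2^⌈log2⌉ (suc ⌈ n /2⌉) (rs (⌈n/2⌉<n n))) ⟩
  2 * 2 ^ ⌈log2⌉ (suc ⌈ n /2⌉) _    ∎
  where
  open ≤-Reasoning
  double-suc : ∀ a → suc (suc (a + a)) ≡ 2 * suc a
  double-suc a = solve (a ∷ [])
  n≤2⌈n/2⌉ : n ≤ ⌈ n /2⌉ + ⌈ n /2⌉
  n≤2⌈n/2⌉ = subst (_≤ ⌈ n /2⌉ + ⌈ n /2⌉) (⌊n/2⌋+⌈n/2⌉≡n n) (+-monoˡ-≤ ⌈ n /2⌉ (⌊n/2⌋≤⌈n/2⌉ n))

n≤2^⌈log₂n⌉ : ∀ n → n ≤ 2 ^ ⌈log₂ n ⌉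
n≤2^⌈log₂n⌉ n = n≤2^⌈log2⌉ n (<-wellFounded n)

data Dir : Set where
  fwd bwd : Dir

reverse : Dir → Dir
reverse fwd = bwd
reverse bwd = fwd

Step : ℕ → Dir → ℕ → ℕ → ℕ → Set
Step m fwd d a b = b ≡ a + d [mod m ]
Step m bwd d a b = a ≡ b + d [mod m ]

module _ {m : ℕ} where

  step-reverse : ∀ s {d a b} → Step m s d a b → Step m (reverse s) d b a
  step-reverse fwd p = p
  step-reverse bwd p = p

  step-target : ∀ s {d a b b'} → Step m s d a b → Step m s d a b' → b ≡ b' [mod m ]
  step-target fwd p p' = ≡mod-trans p (≡mod-sym p')
  step-target bwd {d} p p' = +-cancelʳ-mod d (≡mod-trans (≡mod-sym p) p')

  step-length : ∀ s {d d' a b} → Step m s d a b → Step m s d' a b → d ≡ d' [mod m ]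
  step-length fwd {a = a} p p' = +-cancelˡ-mod a (≡mod-trans (≡mod-sym p) p')
  step-length bwd p p' = step-length fwd p p'

  step-opposite : ∀ s {d d' a b} → Step m s d a b → Step m (reverse s) d' a b →
                  (d + d') ≡ 0 [mod m ]
  step-opposite fwd {d} {d'} {a} {b} p p' = +-cancelˡ-mod a (begin
    a + (d + d')  ≡⟨ +-assoc a d d' ⟨
    a + d + d'    ≈⟨ +-cong-mod (≡mod-sym p) ≡mod-refl ⟩
    b + d'        ≈⟨ p' ⟨
    a             ≡⟨ +-identityʳ a ⟨
    a + 0         ∎)
    where open ≡mod-Reasoning m
  step-opposite bwd p p' = step-opposite fwd p p'

  step-loop : ∀ s {d a} → Step m s d a a → d ≡ 0 [mod m ]
  step-loop s {d} {a} p = +-cancelˡ-mod a (≡mod-trans (≡mod-sym (loop s p)) (≡⇒≡mod (sym (+-identityʳ a))))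
    where
    loop : ∀ s → Step m s d a a → a ≡ a + d [mod m ]
    loop fwd p = p
    loop bwd p = p

  step-scale : ∀ c s {d a b} → Step m s d a b → Step m s (c * d) (c * a) (c * b)
  step-scale c fwd {d} {a} p = ≡mod-trans (*-congˡ-mod c p) (≡⇒≡mod (*-distribˡ-+ c a d))
  step-scale c bwd p = step-scale c fwd p

  step-length-cong : ∀ s {d d' a b} → d ≡ d' [mod m ] → Step m s d a b → Step m s d' a b
  step-length-cong fwd d≡d' p = ≡mod-trans p (+-cong-mod ≡mod-refl d≡d')
  step-length-cong bwd d≡d' p = step-length-cong fwd d≡d' p

  step-endpoint-cong : ∀ s {d a b b'} → b ≡ b' [mod m ] → Step m s d a b → Step m s d a b'
  step-endpoint-cong fwd b≡b' p = ≡mod-trans (≡mod-sym b≡b') p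
  step-endpoint-cong bwd b≡b' p = ≡mod-trans p (+-cong-mod b≡b' ≡mod-refl)

  step-complement : ∀ s {d d' a b} → d + d' ≡ m → Step m s d a b → Step m (reverse s) d' a b
  step-complement fwd {d} {d'} {a} {b} d+d'≡m p = begin
    a              ≈⟨ +-multiple-mod a 1 ⟨
    a + 1 * m      ≡⟨ cong (a +_) (trans (+-identityʳ m) (sym d+d'≡m)) ⟩
    a + (d + d')   ≡⟨ +-assoc a d d' ⟨
    a + d + d'     ≈⟨ +-cong-mod (≡mod-sym p) ≡mod-refl ⟩
    b + d'         ∎
    where open ≡mod-Reasoning m
  step-complement bwd d+d'≡m p = step-complement fwd d+d'≡m p

step-weaken : ∀ {m M} → m ∣ M → ∀ s {d a b} → Step M s d a b → Step m s d a b
step-weaken m∣M fwd p = ≡mod-weaken m∣M p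
step-weaken m∣M bwd p = ≡mod-weaken m∣M p

-- Arithmetic modulo an odd number q = 1 + 2h, where 2 is invertible.
module OddModulus (h : ℕ) where

  q : ℕ
  q = 1 + 2 * h

  instance
    q-nonZero : NonZero q
    q-nonZero = _

  half-double : ∀ a → (suc h * (2 * a)) ≡ a [mod q ]
  half-double a = 0 , a , identity h a
    where
    identity : ∀ h a → suc h * (2 * a) + 0 * (1 + 2 * h) ≡ a + a * (1 + 2 * h)
    identity h a = solve (h ∷ a ∷ [])

  halve : ∀ {a b} → (2 * a) ≡ 2 * b [mod q ] → a ≡ b [mod q ]
  halve {a} {b} 2a≡2b = begin
    a                  ≈⟨ half-double a ⟨
    suc h * (2 * a)    ≈⟨ *-congˡ-mod (suc h) 2a≡2b ⟩
    suc h * (2 * b)    ≈⟨ half-double b ⟩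
    b                  ∎
    where open ≡mod-Reasoning q

  private
    odd-sum≢q : ∀ {d d'} → IsOdd d → IsOdd d' → d + d' ≢ q
    odd-sum≢q {d} {d'} (t , refl) (t' , refl) d+d'≡q = 0ℙ≢1ℙ (begin
      0ℙ                         ≡⟨ cong₂ ℙ._+_ (parity-odd t) (parity-odd t') ⟨
      parity d ℙ.+ parity d'     ≡⟨ ℙₚ.+-homo-+ d d' ⟨
      parity (d + d')            ≡⟨ cong parity d+d'≡q ⟩
      parity q                   ≡⟨ parity-odd h ⟩
      1ℙ                         ∎)
      where
      open ≡-Reasoning
      0ℙ≢1ℙ : 0ℙ ≢ 1ℙ
      0ℙ≢1ℙ ()

    0<odd+ : ∀ {d d'} → IsOdd d → 0 < d + d'
    0<odd+ (t , refl) = s≤s z≤n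

    opposite-odd-steps : ∀ s {d d' a b} → IsOdd d → IsOdd d' → d < q → d' < q →
                         Step q s d a b → Step q (reverse s) d' a b → ⊥
    opposite-odd-steps s d-odd d'-odd d<q d'<q p p' =
      odd-sum≢q d-odd d'-odd (multiple-between (step-opposite s p p') (0<odd+ d-odd) (+-mono-< d<q d'<q))

  -- Odd steps shorter than q are determined by their endpoints: the lengths
  -- of two odd steps in opposite directions would add up to the odd q.
  odd-steps-agree : ∀ s s' {d d' a b} → IsOdd d → IsOdd d' → d < q → d' < q →
                    Step q s d a b → Step q s' d' a b → s ≡ s' × d ≡ d'
  odd-steps-agree fwd fwd _ _ d<q d'<q p p' = refl , ≡mod-unique d<q d'<q (step-length fwd p p')
  odd-steps-agree bwd bwd _ _ d<q d'<q p p' = refl , ≡mod-unique d<q d'<q (step-length bwd p p')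
  odd-steps-agree fwd bwd d-odd d'-odd d<q d'<q p p' = ⊥-elim (opposite-odd-steps fwd d-odd d'-odd d<q d'<q p p')
  odd-steps-agree bwd fwd d-odd d'-odd d<q d'<q p p' = ⊥-elim (opposite-odd-steps bwd d-odd d'-odd d<q d'<q p p')

module Colouring
  (R h c n m : ℕ)
  (R<q : R < 1 + 2 * h) (q≤2+R : 1 + 2 * h ≤ 2 + R) (R≤2^c : R ≤ 2 ^ c)
  (q∣n : 1 + 2 * h ∣ n) (2^[1+c]∣n : 2 ^ suc c ∣ n) (2R<n : 2 * R < n)
  (palette : ∀ d → IsEven d → d ≤ R → 1 + 2 * h + d ≤ m)
  where

  open OddModulus h

  Adj : Fin n → Fin n → Set
  Adj = Circulant n (UpTo R)

  q≤m : q ≤ m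
  q≤m = subst (_≤ m) (+-identityʳ q) (palette 0 (0 , refl) z≤n)

  short<n : ∀ {d} → d ≤ R → d < n
  short<n d≤R = ≤-<-trans d≤R (≤-<-trans (m≤m+n R (R + 0)) 2R<n)

  instance
    n-nonZero : NonZero n
    n-nonZero = >-nonZero (≤-<-trans z≤n 2R<n)
    m-nonZero : NonZero m
    m-nonZero = >-nonZero (≤-trans (s≤s z≤n) q≤m)

  -- Each edge {x, y} is a forward step of length d ≤ R from
  -- a base vertex; as n > 2R this base is determined by the unordered pair.
  -- orientSorted a b (for a ≤ b) is the base vertex and length of {a, b}.
  orientSorted : ℕ → ℕ → ℕ × ℕ
  orientSorted a b with b ∸ a ≤? R
  ... | yes _ = a , b ∸ a
  ... | no _  = b , n ∸ (b ∸ a)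

  orientSorted-short : ∀ {a b} → b ∸ a ≤ R → orientSorted a b ≡ (a , b ∸ a)
  orientSorted-short {a} {b} short with b ∸ a ≤? R
  ... | yes _ = refl
  ... | no long = ⊥-elim (long short)

  orientSorted-long : ∀ {a b} → ¬ (b ∸ a ≤ R) → orientSorted a b ≡ (b , n ∸ (b ∸ a))
  orientSorted-long {a} {b} long with b ∸ a ≤? R
  ... | yes short = ⊥-elim (long short)
  ... | no _ = refl

  complement-long : ∀ {d} → d ≤ R → ¬ (n ∸ d ≤ R)
  complement-long {d} d≤R n-d≤R = <⇒≱ 2R<n (begin
    n            ≡⟨ m∸n+n≡m (<⇒≤ (short<n d≤R)) ⟨
    (n ∸ d) + d  ≤⟨ +-mono-≤ n-d≤R d≤R ⟩
    R + R        ≡⟨ cong (R +_) (+-identityʳ R) ⟨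
    2 * R        ∎)
    where open ≤-Reasoning

  orient : ℕ → ℕ → ℕ × ℕ
  orient x y = orientSorted (x ⊓ y) (x ⊔ y)

  orient-sym : ∀ x y → orient x y ≡ orient y x
  orient-sym x y = cong₂ orientSorted (⊓-comm x y) (⊔-comm x y)

  -- A forward step of length d ≤ R from x is oriented as (x, d), also when
  -- it wraps around (y + n = x + d), as then the arc from y to x is long.
  orient-fwd : ∀ {x y d} → x < n → y < n → d ≤ R → Step n fwd d x y → orient x y ≡ (x , d)
  orient-fwd {x} {y} {d} x<n y<n d≤R p with reduce-sum n x<n y<n (short<n d≤R) p
  ... | inj₁ refl = begin
      orient x (x + d)        ≡⟨ cong₂ orientSorted (m≤n⇒m⊓n≡m (m≤m+n x d)) (m≤n⇒m⊔n≡n (m≤m+n x d)) ⟩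
      orientSorted x (x + d)  ≡⟨ orientSorted-short (subst (_≤ R) (sym (m+n∸m≡n x d)) d≤R) ⟩
      (x , x + d ∸ x)         ≡⟨ cong (x ,_) (m+n∸m≡n x d) ⟩
      (x , d)                 ∎
    where open ≡-Reasoning
  ... | inj₂ y+n≡x+d = begin
      orient x y              ≡⟨ cong₂ orientSorted (m≥n⇒m⊓n≡n y≤x) (m≥n⇒m⊔n≡m y≤x) ⟩
      orientSorted y x        ≡⟨ orientSorted-long (λ short → complement-long d≤R (subst (_≤ R) x-y≡n-d short)) ⟩
      (x , n ∸ (x ∸ y))       ≡⟨ cong (λ z → x , n ∸ z) x-y≡n-d ⟩
      (x , n ∸ (n ∸ d))       ≡⟨ cong (x ,_) (m∸[m∸n]≡n (<⇒≤ (short<n d≤R))) ⟩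
      (x , d)                 ∎
    where
    open ≡-Reasoning
    y≤x : y ≤ x
    y≤x = <⇒≤ (+-cancelʳ-< n y x (subst (_< x + n) (sym y+n≡x+d) (+-monoʳ-< x (short<n d≤R))))
    x-y≡n-d : x ∸ y ≡ n ∸ d
    x-y≡n-d = begin
      x ∸ y              ≡⟨ [m+n]∸[m+o]≡n∸o d x y ⟨
      (d + x) ∸ (d + y)  ≡⟨ cong₂ _∸_ (+-comm d x) (+-comm d y) ⟩
      (x + d) ∸ (y + d)  ≡⟨ cong (_∸ (y + d)) y+n≡x+d ⟨
      (y + n) ∸ (y + d)  ≡⟨ [m+n]∸[m+o]≡n∸o y n d ⟩
      n ∸ d              ∎

  base : Dir → ℕ → ℕ → ℕ
  base fwd x y = x
  base bwd x y = y

  orient-step : ∀ s {x y d} → x < n → y < n → d ≤ R → Step n s d x y → orient x y ≡ (base s x y , d)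
  orient-step fwd x<n y<n d≤R p = orient-fwd x<n y<n d≤R p
  orient-step bwd {x} {y} x<n y<n d≤R p = trans (orient-sym x y) (orient-fwd y<n x<n d≤R p)

  -- Odd lengths get the
  -- colour x + d/2 in ℤ_q (below q); an even length d gets one of the two
  -- colours q + d - 2, q + d - 1, chosen by the parity of the block of x.
  oddColour : ℕ → ℕ → ℕ
  oddColour x d = ((2 * x + d) * suc h) % q

  evenColour : ℕ → ℕ → ℕ
  evenColour x d = q + (d ∸ 2) + bit (parity (block d x))

  colourBy : Parity → ℕ → ℕ → ℕ
  colourBy 0ℙ = evenColour
  colourBy 1ℙ = oddColour

  baseColour : ℕ → ℕ → ℕ
  baseColour x d = colourBy (parity d) x d

  colourOf : ℕ → ℕ → ℕ
  colourOf x y = uncurry baseColour (orient x y)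

  colourOf-step : ∀ s {x y d} → x < n → y < n → d ≤ R → Step n s d x y →
                  colourOf x y ≡ baseColour (base s x y) d
  colourOf-step s x<n y<n d≤R p = cong (uncurry baseColour) (orient-step s x<n y<n d≤R p)

  oddColour-double : ∀ x d → (2 * oddColour x d) ≡ 2 * x + d [mod q ]
  oddColour-double x d = begin
    2 * oddColour x d             ≈⟨ *-congˡ-mod 2 (%-≡mod ((2 * x + d) * suc h)) ⟩
    2 * ((2 * x + d) * suc h)     ≡⟨ solve (x ∷ d ∷ h ∷ []) ⟩
    suc h * (2 * (2 * x + d))     ≈⟨ half-double (2 * x + d) ⟩
    2 * x + d                     ∎
    where open ≡mod-Reasoning q

  odd-view : ∀ s {x y d} → IsOdd d → x < n → y < n → d ≤ R → Step n s d x y →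
             colourOf x y < q × Step q s d (2 * x) (2 * colourOf x y)
  odd-view s {x} {y} {d} d-odd x<n y<n d≤R p =
    subst (_< q) (sym colour≡) (m%n<n ((2 * base s x y + d) * suc h) q) ,
    subst (λ c → Step q s d (2 * x) (2 * c)) (sym colour≡) (doubled s p)
    where
    colour≡ : colourOf x y ≡ oddColour (base s x y) d
    colour≡ = trans (colourOf-step s x<n y<n d≤R p) (cong (λ r → colourBy r (base s x y) d) (IsOdd⇒parity d-odd))
    doubled : ∀ s → Step n s d x y → Step q s d (2 * x) (2 * oddColour (base s x y) d)
    doubled fwd _ = oddColour-double x d
    doubled bwd x≡y+d = begin
      2 * x                    ≈⟨ *-congˡ-mod 2 (≡mod-weaken q∣n x≡y+d) ⟩
      2 * (y + d)              ≡⟨ solve (y ∷ d ∷ []) ⟩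
      2 * y + d + d            ≈⟨ +-cong-mod (oddColour-double y d) ≡mod-refl ⟨
      2 * oddColour y d + d    ∎
      where open ≡mod-Reasoning q

  turn : Dir → Parity → Parity
  turn fwd p = p
  turn bwd p = p ⁻¹

  turn-injective : ∀ s s' {p} → turn s p ≡ turn s' p → s ≡ s'
  turn-injective fwd fwd _ = refl
  turn-injective bwd bwd _ = refl
  turn-injective fwd bwd {p} e = ⊥-elim (ℙₚ.p≢p⁻¹ p e)
  turn-injective bwd fwd {p} e = ⊥-elim (ℙₚ.p≢p⁻¹ p (sym e))

  -- Seen from x, an edge of even length d = 2(1+t) in direction s has colour
  -- q + 2t + (parity of the block of x, flipped when going backwards): going
  -- back by d, an odd multiple of twoPart d, flips the parity of the block.
  even-view : ∀ s {x y t} → x < n → y < n → 2 * suc t ≤ R → Step n s (2 * suc t) x y →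
              colourOf x y ≡ q + 2 * t + bit (turn s (parity (block (2 * suc t) x)))
  even-view s {x} {y} {t} x<n y<n d≤R p = begin
    colourOf x y                                       ≡⟨ colourOf-step s x<n y<n d≤R p ⟩
    colourBy (parity d) (base s x y) d                 ≡⟨ cong (λ r → colourBy r (base s x y) d) (parity-even (suc t)) ⟩
    q + (d ∸ 2) + bit (parity (block d (base s x y)))  ≡⟨ cong₂ (λ a b → q + a + bit b) d-2≡2t (block-parity s p) ⟩
    q + 2 * t + bit (turn s (parity (block d x)))      ∎
    where
    open ≡-Reasoning
    d : ℕ
    d = 2 * suc t
    d-2≡2t : d ∸ 2 ≡ 2 * t
    d-2≡2t = trans (cong (_∸ 2) (double-suc t)) (m+n∸m≡n 2 (2 * t))
      where
      double-suc : ∀ t → 2 * suc t ≡ 2 + 2 * t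
      double-suc t = solve (t ∷ [])
    block-parity : ∀ s → Step n s d x y → parity (block d (base s x y)) ≡ turn s (parity (block d x))
    block-parity fwd _ = refl
    block-parity bwd x≡y+d = trans (sym (ℙₚ.⁻¹-involutive _)) (cong _⁻¹ (sym (
      parity-flip {{twoPart-nonZero d}} (twoPart-∣ (pred d)) (twoPart-cofactor (pred d))
        (∣-trans (double-twoPart-∣ (pred d) {c} (≤-trans d≤R R≤2^c)) 2^[1+c]∣n) x≡y+d)))

  even-colour≥q : ∀ s {x y t} → x < n → y < n → 2 * suc t ≤ R → Step n s (2 * suc t) x y →
                  q ≤ colourOf x y
  even-colour≥q s x<n y<n d≤R p =
    subst (q ≤_) (sym (even-view s x<n y<n d≤R p)) (≤-trans (m≤m+n q _) (m≤m+n _ _))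

  Incidence : ℕ → ℕ → Set
  Incidence x y = ∃[ s ] ∃[ d ] UpTo R d × Step n s d x y

  incidence : ∀ {u v} → Adj u v → Incidence (toℕ u) (toℕ v)
  incidence (_ , d , d∈S , inj₁ u≡v+d) = bwd , d , d∈S , u≡v+d
  incidence (_ , d , d∈S , inj₂ v≡u+d) = fwd , d , d∈S , v≡u+d

  colour<m : ∀ {x y} → x < n → y < n → Incidence x y → colourOf x y < m
  colour<m x<n y<n (s , d , (1≤d , d≤R) , p) with shape 1≤d
  ... | odd t = <-≤-trans (proj₁ (odd-view s (t , refl) x<n y<n d≤R p)) q≤m
  ... | even t = subst (_< m) (sym (even-view s x<n y<n d≤R p)) (begin-strict
    q + 2 * t + bit _  ≤⟨ +-monoʳ-≤ (q + 2 * t) (bit≤1 _) ⟩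
    q + 2 * t + 1      <⟨ +-monoʳ-< (q + 2 * t) (n<1+n 1) ⟩
    q + 2 * t + 2      ≡⟨ regroup q t ⟩
    q + 2 * suc t      ≤⟨ palette (2 * suc t) (suc t , refl) d≤R ⟩
    m                  ∎)
    where
    open ≤-Reasoning
    regroup : ∀ a t → a + 2 * t + 2 ≡ a + 2 * suc t
    regroup a t = solve (a ∷ t ∷ [])

  -- At a fixed vertex, the colour of an edge determines its direction and
  -- length: odd lengths by odd-steps-agree, even ones by their colour value,
  -- and odd and even colours are separated by q.
  colour-determines-step : ∀ s s' {x y y' d d'} → x < n → y < n → y' < n →
    UpTo R d → UpTo R d' → Step n s d x y → Step n s' d' x y' →
    colourOf x y ≡ colourOf x y' → s ≡ s' × d ≡ d'
  colour-determines-step s s' {x} x<n y<n y'<n (1≤d , d≤R) (1≤d' , d'≤R) p p' same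
    with shape 1≤d | shape 1≤d'
  ... | odd t | odd t' =
    odd-steps-agree s s' (t , refl) (t' , refl) (≤-<-trans d≤R R<q) (≤-<-trans d'≤R R<q)
      (proj₂ (odd-view s (t , refl) x<n y<n d≤R p))
      (subst (λ c → Step q s' _ (2 * x) (2 * c)) (sym same) (proj₂ (odd-view s' (t' , refl) x<n y'<n d'≤R p')))
  ... | odd t | even t' = ⊥-elim (<⇒≱ (proj₁ (odd-view s (t , refl) x<n y<n d≤R p))
                                     (subst (q ≤_) (sym same) (even-colour≥q s' x<n y'<n d'≤R p')))
  ... | even t | odd t' = ⊥-elim (<⇒≱ (proj₁ (odd-view s' (t' , refl) x<n y'<n d'≤R p'))
                                     (subst (q ≤_) same (even-colour≥q s x<n y<n d≤R p)))
  ... | even t | even t' with even+bit-injective t t' _ _ (+-cancelˡ-≡ q _ _ (begin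
        q + (2 * t + bit _)   ≡⟨ +-assoc q (2 * t) _ ⟨
        q + 2 * t + bit _     ≡⟨ even-view s x<n y<n d≤R p ⟨
        colourOf x _          ≡⟨ same ⟩
        colourOf x _          ≡⟨ even-view s' x<n y'<n d'≤R p' ⟩
        q + 2 * t' + bit _    ≡⟨ +-assoc q (2 * t') _ ⟩
        q + (2 * t' + bit _)  ∎))
    where open ≡-Reasoning
  ...   | refl , same-turn = turn-injective s s' same-turn , refl

  proper-at : ∀ {x y y'} → x < n → y < n → y' < n → Incidence x y → Incidence x y' →
              colourOf x y ≡ colourOf x y' → y ≡ y'
  proper-at x<n y<n y'<n (s , d , d∈S , p) (s' , d' , d'∈S , p') same
    with colour-determines-step s s' x<n y<n y'<n d∈S d'∈S p p' same
  ... | refl , refl = ≡mod-unique y<n y'<n (step-target s p p')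

  -- The colour x mod q is missing at x: an odd colour c at x satisfies
  -- 2c ≡ 2x ± d with 0 < d < q, and even colours are at least q.
  missing : ∀ {x y} → x < n → y < n → Incidence x y → colourOf x y ≢ x % q
  missing {x} {y} x<n y<n (s , d , (1≤d , d≤R) , p) c≡x%q with shape 1≤d
  ... | even t = <⇒≱ (m%n<n x q) (subst (q ≤_) c≡x%q (even-colour≥q s x<n y<n d≤R p))
  ... | odd t = <⇒≢ (s≤s z≤n) (sym (≡mod-unique (≤-<-trans d≤R R<q) (s≤s z≤n) (step-loop s
        (step-endpoint-cong s 2c≡2x (proj₂ (odd-view s (t , refl) x<n y<n d≤R p))))))
    where
    2c≡2x : (2 * colourOf x y) ≡ 2 * x [mod q ]
    2c≡2x = *-congˡ-mod 2 (≡mod-trans (≡⇒≡mod c≡x%q) (%-≡mod x))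

  -- A step of even length 2e (1 ≤ e ≤ R) modulo q can be replaced by an odd
  -- step of length at most R: q - 2e backwards if 2e < q, else 2e - q.
  odd-replacement : ∀ s {e a b} → 1 ≤ e → e ≤ R → Step q s (2 * e) a b →
                    ∃[ s' ] ∃[ d ] IsOdd d × UpTo R d × Step q s' d a b
  odd-replacement s {e} 1≤e e≤R p with e ≤? h
  ... | yes e≤h = reverse s , d , (h ∸ e , refl) , (s≤s z≤n , d≤R) , step-complement s 2e+d≡q p
    where
    d : ℕ
    d = 1 + 2 * (h ∸ e)
    2e+d≡q : 2 * e + d ≡ q
    2e+d≡q = trans (identity e (h ∸ e)) (cong (λ r → 1 + 2 * r) (m+[n∸m]≡n e≤h))
      where
      identity : ∀ e r → 2 * e + (1 + 2 * r) ≡ 1 + 2 * (e + r)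
      identity e r = solve (e ∷ r ∷ [])
    d≤R : d ≤ R
    d≤R = +-cancelˡ-≤ 2 d R (begin
      2 + d      ≤⟨ +-monoˡ-≤ d (*-monoʳ-≤ 2 1≤e) ⟩
      2 * e + d  ≡⟨ 2e+d≡q ⟩
      q          ≤⟨ q≤2+R ⟩
      2 + R      ∎)
      where open ≤-Reasoning
  ... | no e≰h = s , d , (e ∸ suc h , refl) , (s≤s z≤n , <⇒≤ d<R) ,
                 step-length-cong s (≡mod-trans (≡⇒≡mod 2e≡d+q) (+-multiple-mod d 1)) p
    where
    d : ℕ
    d = 1 + 2 * (e ∸ suc h)
    2e≡d+q : 2 * e ≡ d + 1 * q
    2e≡d+q = trans (cong (2 *_) (sym (m+[n∸m]≡n (≰⇒> e≰h)))) (identity h (e ∸ suc h))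
      where
      identity : ∀ h r → 2 * (suc h + r) ≡ (1 + 2 * r) + 1 * (1 + 2 * h)
      identity h r = solve (h ∷ r ∷ [])
    d<R : d < R
    d<R = +-cancelˡ-< R d R (begin-strict
      R + d      <⟨ +-monoˡ-< d R<q ⟩
      q + d      ≡⟨ trans (+-comm q d) (cong (d +_) (sym (+-identityʳ q))) ⟩
      d + 1 * q  ≡⟨ 2e≡d+q ⟨
      2 * e      ≤⟨ *-monoʳ-≤ 2 e≤R ⟩
      2 * R      ≡⟨ cong (R +_) (+-identityʳ R) ⟩
      R + R      ∎)
      where open ≤-Reasoning

  neighbour : ∀ (v : Fin n) s {d} → UpTo R d → ∃[ w ] Adj v w × Step n s d (toℕ v) (toℕ w)
  neighbour v s {d} d∈S@(1≤d , d≤R) = w , (v≢w , d , d∈S , adjacency s v→w) , v→w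
    where
    y : ℕ
    y = toℕ v
    target : Dir → ℕ
    target fwd = y + d
    target bwd = y + (n ∸ d)
    w : Fin n
    w = target s mod n
    reach : ∀ s {z} → z ≡ target s [mod n ] → Step n s d y z
    reach fwd z≡y+d = z≡y+d
    reach bwd {z} z≡y+n-d = begin
      y                ≈⟨ +-multiple-mod y 1 ⟨
      y + 1 * n        ≡⟨ cong (y +_) (trans (+-identityʳ n) (sym (m∸n+n≡m (<⇒≤ (short<n d≤R))))) ⟩
      y + (n ∸ d + d)  ≡⟨ +-assoc y (n ∸ d) d ⟨
      y + (n ∸ d) + d  ≈⟨ +-cong-mod (≡mod-sym z≡y+n-d) ≡mod-refl ⟩
      z + d            ∎
      where open ≡mod-Reasoning n
    v→w : Step n s d y (toℕ w)
    v→w = reach s (subst (λ z → z ≡ target s [mod n ]) (sym (toℕ-fromℕ< (m%n<n (target s) n)))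
                         (%-≡mod (target s)))
    v≢w : v ≢ w
    v≢w v≡w = <⇒≢ 1≤d (sym (≡mod-unique (short<n d≤R) (≤-<-trans z≤n (short<n d≤R))
                (step-loop s (subst (λ z → Step n s d y (toℕ z)) (sym v≡w) v→w))))
    adjacency : ∀ s {a b} → Step n s d a b → (a ≡ b + d [mod n ]) ⊎ (b ≡ a + d [mod n ])
    adjacency fwd p = inj₂ p
    adjacency bwd p = inj₁ p

  -- The colour x mod q appears at every neighbour y of x: an odd step from
  -- 2y to 2x modulo q of length at most R leads to a neighbour w of y whose
  -- edge yw has colour c with 2c ≡ 2x, i.e. c ≡ x (mod q).
  present : ∀ (u v : Fin n) → Incidence (toℕ u) (toℕ v) →
            ∃[ w ] Adj v w × colourOf (toℕ v) (toℕ w) ≡ toℕ u % q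
  present u v (s , e , (1≤e , e≤R) , p) =
    via-odd-step (odd-replacement (reverse s) 1≤e e≤R
                   (step-reverse s (step-scale 2 s (step-weaken q∣n s p))))
    where
    x y : ℕ
    x = toℕ u
    y = toℕ v
    via-odd-step : (∃[ s' ] ∃[ d ] IsOdd d × UpTo R d × Step q s' d (2 * y) (2 * x)) →
                   ∃[ w ] Adj v w × colourOf y (toℕ w) ≡ x % q
    via-odd-step (s' , d , d-odd , d∈S@(_ , d≤R) , 2y→2x) = via-neighbour (neighbour v s' d∈S)
      where
      via-neighbour : (∃[ w ] Adj v w × Step n s' d y (toℕ w)) → ∃[ w ] Adj v w × colourOf y (toℕ w) ≡ x % q
      via-neighbour (w , v~w , v→w) = w , v~w , ≡mod-unique (proj₁ view) (m%n<n x q) c≡x%q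
        where
        view : colourOf y (toℕ w) < q × Step q s' d (2 * y) (2 * colourOf y (toℕ w))
        view = odd-view s' d-odd (toℕ<n v) (toℕ<n w) d≤R v→w
        c≡x%q : colourOf y (toℕ w) ≡ x % q [mod q ]
        c≡x%q = ≡mod-trans (halve (step-target s' (proj₂ view) 2y→2x)) (≡mod-sym (%-≡mod x))

  colouring : EdgeColoring n m Adj
  colouring = record
    { color = λ u v _ → colourOf (toℕ u) (toℕ v) mod m
    ; symm  = λ u v _ _ → cong (λ e → uncurry baseColour e mod m) (orient-sym (toℕ u) (toℕ v))
    }

  adjacent-colour<m : ∀ {u v} → Adj u v → colourOf (toℕ u) (toℕ v) < m
  adjacent-colour<m u~v = colour<m (toℕ<n _) (toℕ<n _) (incidence u~v)

  mod-injective : ∀ {a b} → a < m → b < m → a mod m ≡ b mod m → a ≡ b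
  mod-injective {a} {b} a<m b<m same = begin
    a              ≡⟨ m<n⇒m%n≡m a<m ⟨
    a % m          ≡⟨ toℕ-fromℕ< (m%n<n a m) ⟨
    toℕ (a mod m)  ≡⟨ cong toℕ same ⟩
    toℕ (b mod m)  ≡⟨ toℕ-fromℕ< (m%n<n b m) ⟩
    b % m          ≡⟨ m<n⇒m%n≡m b<m ⟩
    b              ∎
    where open ≡-Reasoning

  proper : Proper colouring
  proper u v w u~v u~w v≢w same = v≢w (toℕ-injective
    (proper-at (toℕ<n u) (toℕ<n v) (toℕ<n w) (incidence u~v) (incidence u~w)
      (mod-injective (adjacent-colour<m u~v) (adjacent-colour<m u~w) same)))

  -- The colour (x mod q) is present at v but missing at u, for every edge uv.
  avd : AVD colouring
  avd u v u~v same-sets = absent-at-u (proj₂ (same-sets colour-x) present-at-v)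
    where
    x : ℕ
    x = toℕ u
    colour-x : Fin m
    colour-x = x % q mod m
    present-at-v : InColorSet colouring v colour-x
    present-at-v = let (w , v~w , vw-colour) = present u v (incidence u~v)
                   in w , v~w , cong (_mod m) vw-colour
    absent-at-u : ¬ InColorSet colouring u colour-x
    absent-at-u (z , u~z , uz-colour) = missing (toℕ<n u) (toℕ<n z) (incidence u~z)
      (mod-injective (adjacent-colour<m u~z) (<-≤-trans (m%n<n x q) q≤m) uz-colour)

  -- The colour of an edge depends only on its endpoints, so it is well defined.
  avd-colouring : HasAVDColoring n m Adj
  avd-colouring = colouring , (λ _ _ _ _ → refl) , proper , avd

avd-circulant : ∀ R h k q → 1 ≤ k → q ≡ 1 + 2 * h → R < q → q ≤ 2 + R →
  (∀ d → IsEven d → d ≤ R → q + d ≤ 2 * R + 1) →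
  HasAVDColoring (k * q * 2 ^ (1 + ⌈log₂ R ⌉)) (2 * R + 1)
    (Circulant (k * q * 2 ^ (1 + ⌈log₂ R ⌉)) (UpTo R))
avd-circulant R h k .(1 + 2 * h) 1≤k refl R<q q≤2+R palette =
  Colouring.avd-colouring R h c n (2 * R + 1) R<q q≤2+R (n≤2^⌈log₂n⌉ R)
    (∣-trans (n∣m*n k) (m∣m*n (2 ^ suc c))) (n∣m*n (k * q)) 2R<n palette
  where
  q c n : ℕ
  q = 1 + 2 * h
  c = ⌈log₂ R ⌉
  n = k * q * 2 ^ suc c
  2R<n : 2 * R < n
  2R<n = begin-strict
    2 * R            <⟨ *-monoʳ-< 2 R<q ⟩
    2 * q            ≡⟨ *-comm 2 q ⟩
    q * 2            ≤⟨ *-mono-≤ q≤k*q (*-monoʳ-≤ 2 (m^n>0 2 c)) ⟩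
    k * q * (2 * 2 ^ c) ∎
    where
    open ≤-Reasoning
    q≤k*q : q ≤ k * q
    q≤k*q = subst (_≤ k * q) (*-identityˡ q) (*-monoˡ-≤ q 1≤k)

even-case : ∀ R k → 1 ≤ k → IsEven R →
  HasAVDColoring (k * (R + 1) * 2 ^ (1 + ⌈log₂ R ⌉)) (2 * R + 1)
    (Circulant (k * (R + 1) * 2 ^ (1 + ⌈log₂ R ⌉)) (UpTo R))
even-case .(2 * t) k 1≤k (t , refl) =
  avd-circulant (2 * t) t k (2 * t + 1) 1≤k (+-comm (2 * t) 1) (m<m+n (2 * t) (s≤s z≤n))
    (≤-trans (≤-reflexive (+-comm (2 * t) 1)) (n≤1+n _)) palette
  where
  palette : ∀ d → IsEven d → d ≤ 2 * t → 2 * t + 1 + d ≤ 2 * (2 * t) + 1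
  palette d _ d≤2t = begin
    2 * t + 1 + d        ≤⟨ +-monoʳ-≤ (2 * t + 1) d≤2t ⟩
    2 * t + 1 + 2 * t    ≡⟨ solve (t ∷ []) ⟩
    2 * (2 * t) + 1      ∎
    where open ≤-Reasoning

odd-case : ∀ R k → 1 ≤ k → IsOdd R →
  HasAVDColoring (k * (R + 2) * 2 ^ (1 + ⌈log₂ R ⌉)) (2 * R + 1)
    (Circulant (k * (R + 2) * 2 ^ (1 + ⌈log₂ R ⌉)) (UpTo R))
odd-case .(1 + 2 * t) k 1≤k (t , refl) =
  avd-circulant (1 + 2 * t) (suc t) k (1 + 2 * t + 2) 1≤k (solve (t ∷ [])) (m<m+n (1 + 2 * t) (s≤s z≤n))
    (≤-reflexive (+-comm (1 + 2 * t) 2)) palette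
  where
  palette : ∀ d → IsEven d → d ≤ 1 + 2 * t → 1 + 2 * t + 2 + d ≤ 2 * (1 + 2 * t) + 1
  palette .(2 * j) (j , refl) 2j≤1+2t = begin
    1 + 2 * t + 2 + 2 * j  ≤⟨ +-monoʳ-≤ (1 + 2 * t + 2) (*-monoʳ-≤ 2 j≤t) ⟩
    1 + 2 * t + 2 + 2 * t  ≡⟨ solve (t ∷ []) ⟩
    2 * (1 + 2 * t) + 1    ∎
    where
    open ≤-Reasoning
    double-suc : ∀ t → 2 + 2 * t ≡ 2 * suc t
    double-suc t = solve (t ∷ [])
    j≤t : j ≤ t
    j≤t = ≤-pred (*-cancelˡ-< 2 j (suc t) (≤-<-trans 2j≤1+2t (≤-reflexive (double-suc t))))

lemma4 : (R k : ℕ) → 1 ≤ R → 1 ≤ k →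
    (IsEven R →
      HasAVDColoring (k * (R + 1) * 2 ^ (1 + ⌈log₂ R ⌉)) (2 * R + 1)
        (Circulant (k * (R + 1) * 2 ^ (1 + ⌈log₂ R ⌉)) (UpTo R)))
    ×
    (IsOdd R →
      HasAVDColoring (k * (R + 2) * 2 ^ (1 + ⌈log₂ R ⌉)) (2 * R + 1)
        (Circulant (k * (R + 2) * 2 ^ (1 + ⌈log₂ R ⌉)) (UpTo R)))
lemma4 R k _ 1≤k = even-case R k 1≤k , odd-case R k 1≤k
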